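{- Let $p$ be an odd prime with $p \equiv 2 \pmod 3$, and let $c$ be an integer with $1 \le c \le p-1$. Let $M_{p-1} = [m_{ij}]_{1 \le i,j \le p-1}$ be the $(p-1) \times (p-1)$ matrix with entries $m_{ij} = \left[ \frac{j-i+c}{p} \right]$. Then $\det(M_{p-1}) = 1$.
   Context: For an odd prime $p$ and an integer $a$, the cubic residue symbol is defined by $\left[ \frac{a}{p} \right] = 1$ if $a \not\equiv 0 \pmod p$ and $x^3 \equiv a \pmod p$ has an integer solution; $\left[ \frac{a}{p} \right] = -1$ if $x^3 \equiv a \pmod p$ has no integer solution; and $\left[ \frac{a}{p} \right] = 0$ if $a \equiv 0 \pmod p$. -}

module Defs where

open import Data.Nat as ℕ using (ℕ; zero; suc)
open import Data.Integer using (ℤ; +_; -[1+_]; _+_; _*_; _-_; -_; 1ℤ; 0ℤ)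
open import Data.Integer.DivMod using (_%ℕ_)
open import Data.Fin using (Fin; zero; suc; toℕ; punchIn)
open import Data.Fin.Properties using (any?)
open import Data.Product using (∃)
open import Relation.Nullary using (Dec; yes; no)
open import Relation.Binary.PropositionalEquality using (_≡_)

-- Cubic residue symbol [a/p] for modulus p (value for p = 0 is junk; p is prime in use).
-- x^3 ≡ a (mod p) has an integer solution iff it has one with 0 ≤ x < p,
-- so we decide solvability by searching x over Fin p.
cubicSymbol : ℤ → ℕ → ℤ
cubicSymbol a zero = 0ℤ
cubicSymbol a (suc q) with a %ℕ suc q ℕ.≟ 0
... | yes _ = 0ℤ
... | no _ with any? {n = suc q} (λ (x : Fin (suc q)) →
                 ((+ toℕ x) * (+ toℕ x) * (+ toℕ x) - a) %ℕ suc q ℕ.≟ 0)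
...   | yes _ = 1ℤ
...   | no _  = -[1+ 0 ]

sumFin : ∀ n → (Fin n → ℤ) → ℤ
sumFin zero    f = 0ℤ
sumFin (suc n) f = f zero + sumFin n (λ i → f (suc i))

signℤ : ℕ → ℤ
signℤ zero          = 1ℤ
signℤ (suc zero)    = -[1+ 0 ]
signℤ (suc (suc k)) = signℤ k

det : ∀ n → (Fin n → Fin n → ℤ) → ℤ
det zero    M = 1ℤ
det (suc n) M = sumFin (suc n) (λ j →
  signℤ (toℕ j) * M zero j * det n (λ i k → M (suc i) (punchIn j k)))

-- The (p-1)×(p-1) matrix with entries m_ij = [(j - i + c)/p], indices 1..p-1
-- (Fin index r represents r+1; the shift cancels in j - i).
cubicMatrix : (p c : ℕ) → Fin (p ℕ.∸ 1) → Fin (p ℕ.∸ 1) → ℤ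
cubicMatrix p c i j = cubicSymbol ((+ toℕ j) - (+ toℕ i) + (+ c)) p

module Submission where

open import Defs
open import Data.Nat using (ℕ; _%_; _≤_; _∸_)
open import Data.Nat.Primality using (Prime)
open import Data.Integer using (1ℤ)
open import Relation.Binary.PropositionalEquality using (_≡_)

-- Cubing is a bijection modulo p = 3t + 2 (its inverse is r ↦ r^(2t+1), by
-- Fermat's little theorem), so [a/p] is 0 if p ∣ a and 1 otherwise.  With
-- c = k + 1 and p = c + d + 1, M = J - S where J is the all-ones matrix and S
-- is the 0/1 pattern of the positions with j + c ≡ i (mod p); row k and
-- column d of S are empty, every other row and column has a single 1.
-- Subtracting the all-ones row k of M from the other rows, then splitting it
-- into unit rows (all but the one of column d cancel against rows of -S),
-- turns M into a matrix R(k,d) with det R(k,d) = (-1)^d · det R(k-1,d) by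
-- first-row expansion.  So det M = (-1)^(k·d) = 1, as k + d = p - 2 is odd.

module Determinants where

  open import Data.Nat as ℕ using (ℕ; zero; suc; _<?_; s≤s⁻¹)
  import Data.Nat.Properties as ℕP
  open import Data.Integer as ℤ using (ℤ; _+_; _*_; -_; 1ℤ; 0ℤ; -1ℤ)
  import Data.Integer.Properties as ℤP
  open import Data.Integer.Tactic.RingSolver using (solve-∀)
  open import Data.Bool using (if_then_else_)
  open import Data.Fin using (Fin; zero; suc; toℕ; punchIn; punchOut; _≟_; fromℕ<)
  open import Data.Fin.Properties
    using (punchIn-punchOut; punchOut-punchIn; punchInᵢ≢i; punchIn-injective; punchOut-cong; suc-injective;
           toℕ-injective; toℕ-fromℕ<; toℕ<n)
  open import Data.Product using (Σ; _×_; _,_)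
  open import Data.Empty using (⊥-elim)
  open import Function.Bundles using (_⇔_)
  open import Relation.Nullary using (Dec; does; ¬_; yes; no)
  open import Relation.Nullary.Decidable using (dec-true; dec-false; does-⇔)
  open import Relation.Binary.PropositionalEquality

  χ : ∀ {a} {A : Set a} → Dec A → ℤ
  χ a? = if does a? then 1ℤ else 0ℤ

  χ-yes : ∀ {a} {A : Set a} (a? : Dec A) → A → χ a? ≡ 1ℤ
  χ-yes a? x rewrite dec-true a? x = refl

  χ-no : ∀ {a} {A : Set a} (a? : Dec A) → ¬ A → χ a? ≡ 0ℤ
  χ-no a? ¬x rewrite dec-false a? ¬x = refl

  χ-⇔ : ∀ {a b} {A : Set a} {B : Set b} → A ⇔ B → (a? : Dec A) (b? : Dec B) → χ a? ≡ χ b?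
  χ-⇔ A⇔B a? b? = cong (λ t → if t then 1ℤ else 0ℤ) (does-⇔ A⇔B a? b?)

  sum-cong : ∀ n {f g : Fin n → ℤ} → (∀ i → f i ≡ g i) → sumFin n f ≡ sumFin n g
  sum-cong zero    f≗g = refl
  sum-cong (suc n) f≗g = cong₂ _+_ (f≗g zero) (sum-cong n (λ i → f≗g (suc i)))

  sum-zero : ∀ n (f : Fin n → ℤ) → (∀ i → f i ≡ 0ℤ) → sumFin n f ≡ 0ℤ
  sum-zero zero    f f≗0 = refl
  sum-zero (suc n) f f≗0 = cong₂ _+_ (f≗0 zero) (sum-zero n _ (λ i → f≗0 (suc i)))

  sum-linear : ∀ n (α β : ℤ) (f g : Fin n → ℤ) →
    sumFin n (λ i → α * f i + β * g i) ≡ α * sumFin n f + β * sumFin n g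
  sum-linear zero    α β f g = zeros α β
    where
    zeros : ∀ α β → 0ℤ ≡ α * 0ℤ + β * 0ℤ
    zeros = solve-∀
  sum-linear (suc n) α β f g =
    trans (cong (α * f zero + β * g zero +_) (sum-linear n α β (λ i → f (suc i)) (λ i → g (suc i))))
          (regroup α β (f zero) (g zero) _ _)
    where
    regroup : ∀ α β a b s t → α * a + β * b + (α * s + β * t) ≡ α * (a + s) + β * (b + t)
    regroup = solve-∀

  sum-+ : ∀ n (f g : Fin n → ℤ) → sumFin n (λ i → f i + g i) ≡ sumFin n f + sumFin n g
  sum-+ n f g = trans (sum-cong n (λ i → sym (unit (f i) (g i))))
                      (trans (sum-linear n 1ℤ 1ℤ f g) (unit (sumFin n f) (sumFin n g)))
    where
    unit : ∀ a b → 1ℤ * a + 1ℤ * b ≡ a + b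
    unit = solve-∀

  sum-*ˡ : ∀ n (c : ℤ) (f : Fin n → ℤ) → sumFin n (λ i → c * f i) ≡ c * sumFin n f
  sum-*ˡ zero    c f = sym (ℤP.*-zeroʳ c)
  sum-*ˡ (suc n) c f = trans (cong (c * f zero +_) (sum-*ˡ n c (λ i → f (suc i))))
                             (sym (ℤP.*-distribˡ-+ c (f zero) _))

  sum-neg : ∀ n (f : Fin n → ℤ) → sumFin n (λ i → - f i) ≡ - sumFin n f
  sum-neg zero    f = refl
  sum-neg (suc n) f = trans (cong (- f zero +_) (sum-neg n (λ i → f (suc i))))
                            (sym (ℤP.neg-distrib-+ (f zero) _))

  sum-swap : ∀ m n (f : Fin m → Fin n → ℤ) →
    sumFin m (λ i → sumFin n (f i)) ≡ sumFin n (λ j → sumFin m (λ i → f i j))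
  sum-swap zero    n f = sym (sum-zero n _ (λ _ → refl))
  sum-swap (suc m) n f =
    trans (cong (sumFin n (f zero) +_) (sum-swap m n (λ i → f (suc i))))
          (sym (sum-+ n (f zero) (λ j → sumFin m (λ i → f (suc i) j))))

  sum-punchIn : ∀ n (f : Fin (suc n) → ℤ) (j : Fin (suc n)) →
    sumFin (suc n) f ≡ f j + sumFin n (λ k → f (punchIn j k))
  sum-punchIn n       f zero    = refl
  sum-punchIn (suc n) f (suc j) =
    trans (cong (f zero +_) (sum-punchIn n (λ i → f (suc i)) j)) (exchange (f zero) (f (suc j)) _)
    where
    exchange : ∀ a b c → a + (b + c) ≡ b + (a + c)
    exchange = solve-∀

  sum-single : ∀ n (f : Fin (suc n) → ℤ) (j : Fin (suc n)) →
    (∀ k → f (punchIn j k) ≡ 0ℤ) → sumFin (suc n) f ≡ f j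
  sum-single n f j others≡0 =
    trans (sum-punchIn n f j) (trans (cong (f j +_) (sum-zero n _ others≡0)) (ℤP.+-identityʳ (f j)))

  sign-suc : ∀ m → signℤ (suc m) ≡ - signℤ m
  sign-suc zero          = refl
  sign-suc (suc zero)    = refl
  sign-suc (suc (suc m)) = sign-suc m

  sign-+ : ∀ a b → signℤ (a ℕ.+ b) ≡ signℤ a * signℤ b
  sign-+ zero    b = sym (ℤP.*-identityˡ (signℤ b))
  sign-+ (suc a) b = begin
    signℤ (suc (a ℕ.+ b))     ≡⟨ sign-suc (a ℕ.+ b) ⟩
    - signℤ (a ℕ.+ b)         ≡⟨ cong -_ (sign-+ a b) ⟩
    - (signℤ a * signℤ b)     ≡⟨ ℤP.neg-distribˡ-* (signℤ a) (signℤ b) ⟩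
    - signℤ a * signℤ b       ≡⟨ cong (_* signℤ b) (sym (sign-suc a)) ⟩
    signℤ (suc a) * signℤ b   ∎
    where open ≡-Reasoning

  sign-sq : ∀ a → signℤ a * signℤ a ≡ 1ℤ
  sign-sq zero          = refl
  sign-sq (suc zero)    = refl
  sign-sq (suc (suc a)) = sign-sq a

  sign-even : ∀ n → suc n % 2 ≡ 1 → signℤ n ≡ 1ℤ
  sign-even zero          _   = refl
  sign-even (suc zero)    ()
  sign-even (suc (suc n)) odd = sign-even n odd

  sign-product-even : ∀ k d → (k ℕ.+ d) % 2 ≡ 1 → signℤ (k ℕ.* d) ≡ 1ℤ
  sign-product-even zero          d _   = refl
  sign-product-even (suc zero)    d odd = trans (cong signℤ (ℕP.*-identityˡ d)) (sign-even d odd)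
  sign-product-even (suc (suc k)) d odd = begin
    signℤ (d ℕ.+ (d ℕ.+ k ℕ.* d))               ≡⟨ sign-+ d (d ℕ.+ k ℕ.* d) ⟩
    signℤ d * signℤ (d ℕ.+ k ℕ.* d)             ≡⟨ cong (signℤ d *_) (sign-+ d (k ℕ.* d)) ⟩
    signℤ d * (signℤ d * signℤ (k ℕ.* d))       ≡⟨ sym (ℤP.*-assoc (signℤ d) (signℤ d) _) ⟩
    signℤ d * signℤ d * signℤ (k ℕ.* d)         ≡⟨ cong (_* signℤ (k ℕ.* d)) (sign-sq d) ⟩
    1ℤ * signℤ (k ℕ.* d)                        ≡⟨ ℤP.*-identityˡ _ ⟩
    signℤ (k ℕ.* d)                             ≡⟨ sign-product-even k d odd ⟩
    1ℤ                                          ∎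
    where open ≡-Reasoning

  Matrix : ℕ → Set
  Matrix n = Fin n → Fin n → ℤ

  minor : ∀ {n} → Matrix (suc n) → Fin (suc n) → Matrix n
  minor A j i k = A (suc i) (punchIn j k)

  expansionTerm : ∀ {n} → Matrix (suc n) → Fin (suc n) → ℤ
  expansionTerm {n} A j = signℤ (toℕ j) * A zero j * det n (minor A j)

  det-cong : ∀ n {A B : Matrix n} → (∀ i j → A i j ≡ B i j) → det n A ≡ det n B
  det-cong zero    A≗B = refl
  det-cong (suc n) A≗B = sum-cong (suc n) λ j →
    cong₂ (λ a d → signℤ (toℕ j) * a * d) (A≗B zero j) (det-cong n (λ i k → A≗B (suc i) (punchIn j k)))

  SameOffRow : ∀ {n} → Matrix n → Matrix n → Fin n → Set
  SameOffRow A B r = ∀ i → i ≢ r → ∀ j → A i j ≡ B i j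

  minors-same : ∀ {n} {A B : Matrix (suc n)} → SameOffRow A B zero → ∀ j i k → minor A j i k ≡ minor B j i k
  minors-same A≐B j i k = A≐B (suc i) (λ ()) (punchIn j k)

  minors-sameOffRow : ∀ {n} {A B : Matrix (suc n)} {r} → SameOffRow A B (suc r) → ∀ j → SameOffRow (minor A j) (minor B j) r
  minors-sameOffRow A≐B j i i≢r k = A≐B (suc i) (λ eq → i≢r (suc-injective eq)) (punchIn j k)

  -- For r = 0 this is linearity of the expansion coefficients; otherwise it
  -- is linearity of the minors, by induction.
  det-linear : ∀ n (α β : ℤ) (A B C : Matrix n) (r : Fin n) →
    SameOffRow A B r → SameOffRow A C r → (∀ j → A r j ≡ α * B r j + β * C r j) →
    det n A ≡ α * det n B + β * det n C
  det-linear (suc n) α β A B C zero A≐B A≐C rowʳ =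
    trans (sum-cong (suc n) term) (sum-linear (suc n) α β (expansionTerm B) (expansionTerm C))
    where
    distrib : ∀ α β s b c d → s * (α * b + β * c) * d ≡ α * (s * b * d) + β * (s * c * d)
    distrib = solve-∀
    term : ∀ j → expansionTerm A j ≡ α * expansionTerm B j + β * expansionTerm C j
    term j = begin
      signℤ (toℕ j) * A zero j * det n (minor A j)
        ≡⟨ cong₂ (λ a d → signℤ (toℕ j) * a * d) (rowʳ j) (det-cong n (minors-same A≐B j)) ⟩
      signℤ (toℕ j) * (α * B zero j + β * C zero j) * det n (minor B j)
        ≡⟨ distrib α β (signℤ (toℕ j)) (B zero j) (C zero j) _ ⟩
      α * (signℤ (toℕ j) * B zero j * det n (minor B j)) + β * (signℤ (toℕ j) * C zero j * det n (minor B j))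
        ≡⟨ cong (λ d → α * (signℤ (toℕ j) * B zero j * det n (minor B j)) + β * (signℤ (toℕ j) * C zero j * d))
                (trans (sym (det-cong n (minors-same A≐B j))) (det-cong n (minors-same A≐C j))) ⟩
      α * (signℤ (toℕ j) * B zero j * det n (minor B j)) + β * (signℤ (toℕ j) * C zero j * det n (minor C j)) ∎
      where open ≡-Reasoning
  det-linear (suc n) α β A B C (suc r) A≐B A≐C rowʳ =
    trans (sum-cong (suc n) term) (sum-linear (suc n) α β (expansionTerm B) (expansionTerm C))
    where
    distrib : ∀ α β s a d e → s * a * (α * d + β * e) ≡ α * (s * a * d) + β * (s * a * e)
    distrib = solve-∀
    term : ∀ j → expansionTerm A j ≡ α * expansionTerm B j + β * expansionTerm C j
    term j = begin
      signℤ (toℕ j) * A zero j * det n (minor A j)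
        ≡⟨ cong (signℤ (toℕ j) * A zero j *_)
                (det-linear n α β _ _ _ r (minors-sameOffRow A≐B j) (minors-sameOffRow A≐C j) (λ k → rowʳ (punchIn j k))) ⟩
      signℤ (toℕ j) * A zero j * (α * det n (minor B j) + β * det n (minor C j))
        ≡⟨ distrib α β (signℤ (toℕ j)) (A zero j) _ _ ⟩
      α * (signℤ (toℕ j) * A zero j * det n (minor B j)) + β * (signℤ (toℕ j) * A zero j * det n (minor C j))
        ≡⟨ cong₂ (λ b c → α * (signℤ (toℕ j) * b * det n (minor B j)) + β * (signℤ (toℕ j) * c * det n (minor C j)))
                 (A≐B zero (λ ()) j) (A≐C zero (λ ()) j) ⟩
      α * (signℤ (toℕ j) * B zero j * det n (minor B j)) + β * (signℤ (toℕ j) * C zero j * det n (minor C j)) ∎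
      where open ≡-Reasoning

  det-add : ∀ n (A B C : Matrix n) (r : Fin n) →
    SameOffRow A B r → SameOffRow A C r → (∀ j → A r j ≡ B r j + C r j) →
    det n A ≡ det n B + det n C
  det-add n A B C r A≐B A≐C rowʳ =
    trans (det-linear n 1ℤ 1ℤ A B C r A≐B A≐C (λ j → trans (rowʳ j) (sym (unit (B r j) (C r j)))))
          (unit (det n B) (det n C))
    where
    unit : ∀ a b → 1ℤ * a + 1ℤ * b ≡ a + b
    unit = solve-∀

  det-scale : ∀ n (A B : Matrix n) (r : Fin n) (c : ℤ) →
    SameOffRow A B r → (∀ j → A r j ≡ c * B r j) → det n A ≡ c * det n B
  det-scale n A B r c A≐B rowʳ =
    trans (det-linear n c 0ℤ A B B r A≐B A≐B (λ j → trans (rowʳ j) (sym (drop c (B r j)))))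
          (drop c (det n B))
    where
    drop : ∀ c b → c * b + 0ℤ * b ≡ c * b
    drop = solve-∀

  -- Expanding det along row 0 and then along row 1 of each minor indexes the
  -- terms by pairs (j , k): row 0 uses column j, row 1 column punchIn j k.
  -- Exchanging rows 0 and 1 corresponds to (j , k) ↦ (punchIn j k , partner j k),
  -- which keeps the set of remaining columns and flips the sign of the term.

  -- The position of column j among the columns other than punchIn j k.
  partner : ∀ {n} → Fin (suc (suc n)) → Fin (suc n) → Fin (suc n)
  partner         zero    k       = zero
  partner         (suc j) zero    = j
  partner {suc n} (suc j) (suc k) = suc (partner j k)

  partner-column : ∀ {n} (j : Fin (suc (suc n))) (k : Fin (suc n)) → punchIn (punchIn j k) (partner j k) ≡ j
  partner-column         zero    k       = refl
  partner-column         (suc j) zero    = refl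
  partner-column {suc n} (suc j) (suc k) = cong suc (partner-column j k)

  remaining-columns : ∀ {n} (j : Fin (suc (suc n))) (k : Fin (suc n)) (x : Fin n) →
    punchIn j (punchIn k x) ≡ punchIn (punchIn j k) (punchIn (partner j k) x)
  remaining-columns         zero    k       x       = refl
  remaining-columns         (suc j) zero    x       = refl
  remaining-columns {suc n} (suc j) (suc k) zero    = refl
  remaining-columns {suc n} (suc j) (suc k) (suc x) = cong suc (remaining-columns j k x)

  sign-suc² : ∀ a b → signℤ (suc a) * signℤ (suc b) ≡ signℤ a * signℤ b
  sign-suc² a b = trans (cong₂ _*_ (sign-suc a) (sign-suc b)) (neg*neg (signℤ a) (signℤ b))
    where
    neg*neg : ∀ x y → (- x) * (- y) ≡ x * y
    neg*neg = solve-∀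

  partner-sign : ∀ {n} (j : Fin (suc (suc n))) (k : Fin (suc n)) →
    signℤ (toℕ (punchIn j k)) * signℤ (toℕ (partner j k)) ≡ - (signℤ (toℕ j) * signℤ (toℕ k))
  partner-sign zero k =
    trans (ℤP.*-identityʳ _) (trans (sign-suc (toℕ k)) (cong -_ (sym (ℤP.*-identityˡ _))))
  partner-sign (suc j) zero =
    trans (ℤP.*-identityˡ _) (trans (sym (ℤP.neg-involutive _))
          (cong -_ (trans (sym (sign-suc (toℕ j))) (sym (ℤP.*-identityʳ _)))))
  partner-sign {suc n} (suc j) (suc k) =
    trans (sign-suc² (toℕ (punchIn j k)) (toℕ (partner j k)))
          (trans (partner-sign j k) (cong -_ (sym (sign-suc² (toℕ j) (toℕ k)))))

  -- Extend g to a square array G with zero diagonal (G j l = g j k for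
  -- l = punchIn j k); its row sums are those of g and its column sums are
  -- the reindexed ones, so the claim is the interchange of summation.
  module _ {n : ℕ} (g : Fin (suc (suc n)) → Fin (suc n) → ℤ) where

    private
      G : Fin (suc (suc n)) → Fin (suc (suc n)) → ℤ
      G j l with j ≟ l
      ... | yes _   = 0ℤ
      ... | no j≢l  = g j (punchOut j≢l)

      G-diagonal : ∀ j → G j j ≡ 0ℤ
      G-diagonal j with j ≟ j
      ... | yes _  = refl
      ... | no j≢j = ⊥-elim (j≢j refl)

      G-row : ∀ j k → G j (punchIn j k) ≡ g j k
      G-row j k with j ≟ punchIn j k
      ... | yes eq  = ⊥-elim (punchInᵢ≢i j k (sym eq))
      ... | no j≢l  = cong (g j) (trans (punchOut-cong j refl) (punchOut-punchIn j))

      G-column : ∀ l k → G (punchIn l k) l ≡ g (punchIn l k) (partner l k)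
      G-column l k with punchIn l k ≟ l
      ... | yes eq  = ⊥-elim (punchInᵢ≢i l k eq)
      ... | no ne   = cong (g (punchIn l k))
        (punchIn-injective (punchIn l k) _ _ (trans (punchIn-punchOut ne) (sym (partner-column l k))))

      row-sum : ∀ j → sumFin (suc (suc n)) (G j) ≡ sumFin (suc n) (g j)
      row-sum j = trans (sum-punchIn (suc n) (G j) j)
        (trans (cong₂ _+_ (G-diagonal j) (sum-cong (suc n) (G-row j))) (ℤP.+-identityˡ _))

      column-sum : ∀ l → sumFin (suc (suc n)) (λ j → G j l) ≡ sumFin (suc n) (λ k → g (punchIn l k) (partner l k))
      column-sum l = trans (sum-punchIn (suc n) (λ j → G j l) l)
        (trans (cong₂ _+_ (G-diagonal l) (sum-cong (suc n) (G-column l))) (ℤP.+-identityˡ _))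

    sum-pairs-reindex :
      sumFin (suc (suc n)) (λ j → sumFin (suc n) (g j)) ≡
      sumFin (suc (suc n)) (λ j → sumFin (suc n) (λ k → g (punchIn j k) (partner j k)))
    sum-pairs-reindex = trans (sym (sum-cong _ row-sum))
      (trans (sum-swap (suc (suc n)) (suc (suc n)) G) (sum-cong _ column-sum))

  twoRowTerm : ∀ {n} → Matrix (suc (suc n)) → Fin (suc (suc n)) → Fin (suc n) → ℤ
  twoRowTerm {n} A j k =
    signℤ (toℕ j) * signℤ (toℕ k) * A zero j * A (suc zero) (punchIn j k) * det n (minor (minor A j) k)

  det-two-rows : ∀ n (A : Matrix (suc (suc n))) →
    det (suc (suc n)) A ≡ sumFin (suc (suc n)) (λ j → sumFin (suc n) (twoRowTerm A j))
  det-two-rows n A = sum-cong (suc (suc n)) λ j →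
    trans (sym (sum-*ˡ (suc n) (signℤ (toℕ j) * A zero j) (expansionTerm (minor A j))))
          (sum-cong (suc n) λ k → regroup (signℤ (toℕ j)) (A zero j) (signℤ (toℕ k))
                                              (A (suc zero) (punchIn j k)) (det n (minor (minor A j) k)))
    where
    regroup : ∀ s a t b d → s * a * (t * b * d) ≡ s * t * a * b * d
    regroup = solve-∀

  det-swap01 : ∀ n (A B : Matrix (suc (suc n))) →
    (∀ j → B zero j ≡ A (suc zero) j) → (∀ j → B (suc zero) j ≡ A zero j) →
    (∀ i j → B (suc (suc i)) j ≡ A (suc (suc i)) j) → det (suc (suc n)) B ≡ - det (suc (suc n)) A
  det-swap01 n A B row0 row1 rows = begin
    det (suc (suc n)) B
      ≡⟨ det-two-rows n B ⟩
    sumFin (suc (suc n)) (λ j → sumFin (suc n) (twoRowTerm B j))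
      ≡⟨ sum-pairs-reindex (twoRowTerm B) ⟩
    sumFin (suc (suc n)) (λ j → sumFin (suc n) (λ k → twoRowTerm B (punchIn j k) (partner j k)))
      ≡⟨ sum-cong (suc (suc n)) (λ j → trans (sum-cong (suc n) (swapped-term j)) (sum-neg (suc n) (twoRowTerm A j))) ⟩
    sumFin (suc (suc n)) (λ j → - sumFin (suc n) (twoRowTerm A j))
      ≡⟨ sum-neg (suc (suc n)) (λ j → sumFin (suc n) (twoRowTerm A j)) ⟩
    - sumFin (suc (suc n)) (λ j → sumFin (suc n) (twoRowTerm A j))
      ≡⟨ cong -_ (sym (det-two-rows n A)) ⟩
    - det (suc (suc n)) A ∎
    where
    open ≡-Reasoning
    flip-sign : ∀ s t s′ t′ a b d → s′ * t′ ≡ - (s * t) → s′ * t′ * b * a * d ≡ - (s * t * a * b * d)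
    flip-sign s t s′ t′ a b d eq rewrite eq = ring s t a b d
      where
      ring : ∀ s t a b d → - (s * t) * b * a * d ≡ - (s * t * a * b * d)
      ring = solve-∀
    swapped-term : ∀ j k → twoRowTerm B (punchIn j k) (partner j k) ≡ - twoRowTerm A j k
    swapped-term j k = begin
      twoRowTerm B (punchIn j k) (partner j k)
        ≡⟨ cong₂ (λ a b → signℤ (toℕ (punchIn j k)) * signℤ (toℕ (partner j k)) * a * b
                            * det n (minor (minor B (punchIn j k)) (partner j k)))
                 (row0 (punchIn j k)) (trans (row1 _) (cong (A zero) (partner-column j k))) ⟩
      signℤ (toℕ (punchIn j k)) * signℤ (toℕ (partner j k)) * A (suc zero) (punchIn j k) * A zero j
        * det n (minor (minor B (punchIn j k)) (partner j k))
        ≡⟨ cong (signℤ (toℕ (punchIn j k)) * signℤ (toℕ (partner j k)) * A (suc zero) (punchIn j k) * A zero j *_)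
                (det-cong n (λ i x → trans (rows i _) (cong (A (suc (suc i))) (sym (remaining-columns j k x))))) ⟩
      signℤ (toℕ (punchIn j k)) * signℤ (toℕ (partner j k)) * A (suc zero) (punchIn j k) * A zero j
        * det n (minor (minor A j) k)
        ≡⟨ flip-sign (signℤ (toℕ j)) (signℤ (toℕ k)) (signℤ (toℕ (punchIn j k))) (signℤ (toℕ (partner j k)))
                     (A zero j) (A (suc zero) (punchIn j k)) (det n (minor (minor A j) k)) (partner-sign j k) ⟩
      - twoRowTerm A j k ∎

  -- Rows 0 and 1 equal:
  -- det-swap01 gives det A = - det A.  Rows 0 and s ≥ 2 equal: exchange rows
  -- 0 and 1, after which every minor has two equal rows.  Two equal rows
  -- below the first: every minor has two equal rows.
  exchange01 : ∀ {n} → Fin (suc (suc n)) → Fin (suc (suc n))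
  exchange01 zero          = suc zero
  exchange01 (suc zero)    = zero
  exchange01 (suc (suc i)) = suc (suc i)

  self-negating : ∀ (x : ℤ) → x ≡ - x → x ≡ 0ℤ
  self-negating (ℤ.+ zero)  _  = refl
  self-negating (ℤ.+ suc n) ()
  self-negating ℤ.-[1+ n ]  ()

  term-vanishes : ∀ {n} (A : Matrix (suc n)) j → det n (minor A j) ≡ 0ℤ → expansionTerm A j ≡ 0ℤ
  term-vanishes A j minor≡0 = trans (cong (signℤ (toℕ j) * A zero j *_) minor≡0) (ℤP.*-zeroʳ (signℤ (toℕ j) * A zero j))

  mutual
    det-equal-rows : ∀ n (A : Matrix n) (r s : Fin n) → r ≢ s → (∀ j → A r j ≡ A s j) → det n A ≡ 0ℤ
    det-equal-rows (suc n) A zero    s       r≢s same = det-equal-first-row n A s r≢s same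
    det-equal-rows (suc n) A (suc r) zero    r≢s same =
      det-equal-first-row n A (suc r) (λ eq → r≢s (sym eq)) (λ j → sym (same j))
    det-equal-rows (suc n) A (suc r) (suc s) r≢s same = sum-zero (suc n) _ λ j →
      term-vanishes A j (det-equal-rows n (minor A j) r s (λ eq → r≢s (cong suc eq)) (λ k → same (punchIn j k)))

    det-equal-first-row : ∀ n (A : Matrix (suc n)) (s : Fin (suc n)) → zero ≢ s → (∀ j → A zero j ≡ A s j) →
      det (suc n) A ≡ 0ℤ
    det-equal-first-row n       A zero          0≢s same = ⊥-elim (0≢s refl)
    det-equal-first-row (suc n) A (suc zero)    0≢s same =
      self-negating _ (det-swap01 n A A same (λ j → sym (same j)) (λ i j → refl))
    det-equal-first-row (suc n) A (suc (suc s)) 0≢s same =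
      trans (sym (ℤP.neg-involutive _)) (cong -_ (trans (sym (det-swap01 n A B (λ _ → refl) (λ _ → refl) (λ _ _ → refl)))
        (sum-zero (suc (suc n)) _ λ j →
          term-vanishes B j (det-equal-rows (suc n) (minor B j) zero (suc s) (λ ()) (λ k → same (punchIn j k))))))
      where
      B : Matrix (suc (suc n))
      B i = A (exchange01 i)

  setRow : ∀ {n} → Matrix n → Fin n → (Fin n → ℤ) → Matrix n
  setRow A r v i j with i ≟ r
  ... | yes _ = v j
  ... | no  _ = A i j

  setRow-≡ : ∀ {n} (A : Matrix n) r v j → setRow A r v r j ≡ v j
  setRow-≡ A r v j with r ≟ r
  ... | yes _  = refl
  ... | no r≢r = ⊥-elim (r≢r refl)

  setRow-≢ : ∀ {n} (A : Matrix n) r v {i} → i ≢ r → ∀ j → setRow A r v i j ≡ A i j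
  setRow-≢ A r v {i} i≢r j with i ≟ r
  ... | yes i≡r = ⊥-elim (i≢r i≡r)
  ... | no  _   = refl

  setRow-sameOffRow : ∀ {n} (A : Matrix n) r v → SameOffRow A (setRow A r v) r
  setRow-sameOffRow A r v i i≢r j = sym (setRow-≢ A r v i≢r j)

  -- A row equal to the negative of another row forces det = 0: pull out the
  -- factor -1 and obtain a matrix with two equal rows.
  det-negated-row : ∀ n (A : Matrix n) r s → r ≢ s → (∀ j → A r j ≡ - A s j) → det n A ≡ 0ℤ
  det-negated-row n A r s r≢s row-r =
    trans (det-scale n A (setRow A r (A s)) r -1ℤ (setRow-sameOffRow A r (A s))
            (λ j → trans (row-r j) (trans (sym (ℤP.-1*i≡-i (A s j))) (cong (-1ℤ *_) (sym (setRow-≡ A r (A s) j))))))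
          (cong (-1ℤ *_) (det-equal-rows n _ r s r≢s
            (λ j → trans (setRow-≡ A r (A s) j) (sym (setRow-≢ A r (A s) (λ s≡r → r≢s (sym s≡r)) j)))))

  det-subtract-row : ∀ n (A B : Matrix n) (r z : Fin n) → r ≢ z → SameOffRow A B r →
    (∀ j → A r j ≡ A z j + B r j) → det n A ≡ det n B
  det-subtract-row n A B r z r≢z A≐B row-r =
    trans (det-add n A (setRow A r (A z)) B r (setRow-sameOffRow A r (A z)) A≐B
            (λ j → trans (row-r j) (cong (_+ B r j) (sym (setRow-≡ A r (A z) j)))))
          (trans (cong (_+ det n B) (det-equal-rows n _ r z r≢z
                    (λ j → trans (setRow-≡ A r (A z) j) (sym (setRow-≢ A r (A z) (λ z≡r → r≢z (sym z≡r)) j)))))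
                 (ℤP.+-identityˡ (det n B)))

  det-row-sum : ∀ n (A : Matrix n) r m (F : Fin m → Fin n → ℤ) →
    (∀ j → A r j ≡ sumFin m (λ t → F t j)) →
    det n A ≡ sumFin m (λ t → det n (setRow A r (F t)))
  det-row-sum n A r zero F row-r =
    det-scale n A A r 0ℤ (λ _ _ _ → refl) row-r
  det-row-sum n A r (suc m) F row-r =
    trans (det-add n A (setRow A r (F zero)) (setRow A r rest) r
            (setRow-sameOffRow A r _) (setRow-sameOffRow A r _)
            (λ j → trans (row-r j) (sym (cong₂ _+_ (setRow-≡ A r (F zero) j) (setRow-≡ A r rest j)))))
          (cong (det n (setRow A r (F zero)) +_)
            (trans (det-row-sum n (setRow A r rest) r m (λ t → F (suc t)) (setRow-≡ A r rest))
                   (sum-cong m (λ t → det-cong n (setRow-twice (F (suc t)))))))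
    where
    rest : Fin n → ℤ
    rest j = sumFin m (λ t → F (suc t) j)
    setRow-twice : ∀ v i j → setRow (setRow A r rest) r v i j ≡ setRow A r v i j
    setRow-twice v i j with i ≟ r
    ... | yes _   = refl
    ... | no i≢r  = setRow-≢ A r rest i≢r j

  det-single-entry : ∀ m (A : Matrix (suc m)) v a → A zero v ≡ a →
    (∀ k → A zero (punchIn v k) ≡ 0ℤ) →
    det (suc m) A ≡ signℤ (toℕ v) * a * det m (minor A v)
  det-single-entry m A v a entry others =
    trans (sum-single m (expansionTerm A) v
            (λ k → trans (cong (λ x → signℤ (toℕ (punchIn v k)) * x * det m (minor A (punchIn v k))) (others k))
                         (cong (_* det m (minor A (punchIn v k))) (ℤP.*-zeroʳ (signℤ (toℕ (punchIn v k)))))))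
          (cong (λ x → signℤ (toℕ v) * x * det m (minor A v)) entry)

  unitRow : ∀ {n} → Fin n → Fin n → ℤ
  unitRow t j = χ (j ≟ t)

  negIdentity : ∀ n → Matrix n
  negIdentity n i j = - unitRow i j

  det-neg-identity : ∀ n → det n (negIdentity n) ≡ signℤ n
  det-neg-identity zero    = refl
  det-neg-identity (suc n) = begin
    det (suc n) (negIdentity (suc n))          ≡⟨ det-single-entry n (negIdentity (suc n)) zero -1ℤ refl (λ _ → refl) ⟩
    1ℤ * -1ℤ * det n (negIdentity n)           ≡⟨ cong (-1ℤ *_) (det-neg-identity n) ⟩
    -1ℤ * signℤ n                              ≡⟨ ℤP.-1*i≡-i (signℤ n) ⟩
    - signℤ n                                  ≡⟨ sym (sign-suc n) ⟩
    signℤ (suc n)                              ∎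
    where open ≡-Reasoning

  -- The rows are replaced
  -- one at a time in index order, each step being det-subtract-row.
  module _ {n} (A W : Matrix n) (z : Fin n)
           (row-z : ∀ j → W z j ≡ A z j) (rows : ∀ i → i ≢ z → ∀ j → A i j ≡ A z j + W i j) where

    private
      mixed : ℕ → Matrix n
      mixed t i j with toℕ i <? t
      ... | yes _ = W i j
      ... | no  _ = A i j

      mixed-z : ∀ t j → mixed t z j ≡ A z j
      mixed-z t j with toℕ z <? t
      ... | yes _ = row-z j
      ... | no  _ = refl

      mixed-before : ∀ r j → mixed (toℕ r) r j ≡ A r j
      mixed-before r j with toℕ r <? toℕ r
      ... | yes r<r = ⊥-elim (ℕP.n≮n (toℕ r) r<r)
      ... | no  _   = refl

      mixed-after : ∀ r j → mixed (suc (toℕ r)) r j ≡ W r j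
      mixed-after r j with toℕ r <? suc (toℕ r)
      ... | yes _   = refl
      ... | no  r≮r = ⊥-elim (r≮r (ℕP.n<1+n (toℕ r)))

      mixed-step : ∀ r → SameOffRow (mixed (toℕ r)) (mixed (suc (toℕ r))) r
      mixed-step r i i≢r j with toℕ i <? toℕ r | toℕ i <? suc (toℕ r)
      ... | yes _   | yes _    = refl
      ... | no  _   | no  _    = refl
      ... | yes i<r | no  i≮r′ = ⊥-elim (i≮r′ (ℕP.m<n⇒m<1+n i<r))
      ... | no  i≮r | yes i<r′ = ⊥-elim (i≢r (toℕ-injective (ℕP.≤-antisym (s≤s⁻¹ i<r′) (ℕP.≮⇒≥ i≮r))))

      det-step : ∀ r → det n (mixed (toℕ r)) ≡ det n (mixed (suc (toℕ r)))
      det-step r with r ≟ z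
      ... | yes refl = det-cong n agree
        where
        agree : ∀ i j → mixed (toℕ r) i j ≡ mixed (suc (toℕ r)) i j
        agree i j with i ≟ r
        ... | yes refl = trans (mixed-z (toℕ r) j) (sym (mixed-z (suc (toℕ r)) j))
        ... | no  i≢r  = mixed-step r i i≢r j
      ... | no  r≢z  = det-subtract-row n _ _ r z r≢z (mixed-step r) λ j →
        trans (mixed-before r j) (trans (rows r r≢z j) (sym (cong₂ _+_ (mixed-z (toℕ r) j) (mixed-after r j))))

      det-sweep : ∀ t → t ℕ.≤ n → det n A ≡ det n (mixed t)
      det-sweep zero    _   = det-cong n (λ i j → refl)
      det-sweep (suc t) t<n = trans (det-sweep t (ℕP.<⇒≤ t<n)) (subst (λ s → det n (mixed s) ≡ det n (mixed (suc s)))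
                                                                    (toℕ-fromℕ< t<n) (det-step (fromℕ< t<n)))

      mixed-all : ∀ i j → mixed n i j ≡ W i j
      mixed-all i j with toℕ i <? n
      ... | yes _   = refl
      ... | no  i≮n = ⊥-elim (i≮n (toℕ<n i))

    det-clear-by-row : det n A ≡ det n W
    det-clear-by-row = trans (det-sweep n ℕP.≤-refl) (det-cong n mixed-all)

  -- A row of ones is Σ_t (unit row t).  If for every t ≠ v some other row is
  -- - (unit row t), all those summands have determinant zero, and only the
  -- unit row v survives.
  det-ones-row : ∀ m (U B : Matrix (suc m)) (z v : Fin (suc m)) →
    (∀ j → U z j ≡ 1ℤ) →
    (∀ k → Σ (Fin (suc m)) λ i → (i ≢ z) × (∀ j → U i j ≡ - unitRow (punchIn v k) j)) →
    SameOffRow U B z → (∀ j → B z j ≡ unitRow v j) →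
    det (suc m) U ≡ det (suc m) B
  det-ones-row m U B z v ones cancels U≐B row-z = begin
    det (suc m) U
      ≡⟨ det-row-sum (suc m) U z (suc m) unitRow (λ j → trans (ones j) (sym (column-of-ones j))) ⟩
    sumFin (suc m) (λ t → det (suc m) (setRow U z (unitRow t)))
      ≡⟨ sum-single m (λ t → det (suc m) (setRow U z (unitRow t))) v vanishing ⟩
    det (suc m) (setRow U z (unitRow v))
      ≡⟨ det-cong (suc m) matches-B ⟩
    det (suc m) B ∎
    where
    open ≡-Reasoning
    column-of-ones : ∀ j → sumFin (suc m) (λ t → unitRow t j) ≡ 1ℤ
    column-of-ones j = trans (sum-single m (λ t → unitRow t j) j
                               (λ k → χ-no (j ≟ punchIn j k) (λ eq → punchInᵢ≢i j k (sym eq))))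
                             (χ-yes (j ≟ j) refl)
    vanishing : ∀ k → det (suc m) (setRow U z (unitRow (punchIn v k))) ≡ 0ℤ
    vanishing k with cancels k
    ... | i , i≢z , row-i = det-negated-row (suc m) (setRow U z (unitRow (punchIn v k))) z i (λ eq → i≢z (sym eq)) λ j → begin
      setRow U z (unitRow (punchIn v k)) z j  ≡⟨ setRow-≡ U z _ j ⟩
      unitRow (punchIn v k) j                 ≡⟨ sym (ℤP.neg-involutive _) ⟩
      - - unitRow (punchIn v k) j             ≡⟨ cong -_ (sym (row-i j)) ⟩
      - U i j                                 ≡⟨ cong -_ (sym (setRow-≢ U z _ i≢z j)) ⟩
      - setRow U z (unitRow (punchIn v k)) i j ∎
    matches-B : ∀ i j → setRow U z (unitRow v) i j ≡ B i j
    matches-B i j with i ≟ z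
    ... | yes refl = sym (row-z j)
    ... | no  i≢z  = U≐B i i≢z j

module FermatLittleTheorem where

  open import Data.Nat as ℕ using (ℕ; zero; suc; _+_; _*_; _^_; _<_; _∸_; _%_; _!; z≤n; s≤s)
  import Data.Nat.Properties as ℕP
  open import Data.Nat.DivMod using (m/n*n≡m; [m+kn]%n≡m%n; %-distribˡ-+)
  open import Data.Nat.Divisibility using (_∣_; divides; ∣1⇒≡1; ∣⇒≤; m∣m*n; ∣m⇒∣m*n)
  open import Data.Nat.Primality using (Prime; euclidsLemma; prime⇒nonTrivial)
  open import Data.Nat.Combinatorics using (_C_; nCn≡1; k![n∸k]!∣n!)
  open import Data.Nat.Combinatorics.Specification using (nCk≡n!/k![n-k]!)
  open import Data.Nat.Tactic.RingSolver using (solve-∀)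
  open import Data.Fin using (Fin; zero; suc; toℕ; fromℕ)
  open import Data.Fin.Properties using (toℕ-fromℕ)
  open import Data.Product using (∃; _,_)
  open import Data.Sum using (inj₁; inj₂)
  open import Data.Empty using (⊥-elim)
  import Data.Vec.Functional as Vector
  open import Relation.Nullary using (¬_)
  open import Relation.Binary.PropositionalEquality
  import Algebra.Properties.CommutativeSemiring.Binomial ℕP.+-*-commutativeSemiring as Binomial
  import Algebra.Definitions.RawSemiring ℕ.+-*-rawSemiring as Generic

  generic-^ : ∀ x n → x Generic.^ n ≡ x ^ n
  generic-^ x zero    = refl
  generic-^ x (suc n) = cong (x *_) (generic-^ x n)

  generic-× : ∀ n x → n Generic.× x ≡ n * x
  generic-× zero    x = refl
  generic-× (suc n) x = cong (x +_) (generic-× n x)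

  -- Fermat's little theorem a^p ≡ a (mod p), from the freshman's dream
  -- (x + y)^p ≡ x^p + y^p (mod p), which holds because p divides the binomial
  -- coefficients p C k for 0 < k < p.
  module _ (q : ℕ) (p-prime : Prime (suc q)) where

    private
      p : ℕ
      p = suc q

    prime∤factorial : ∀ m → m < p → ¬ (p ∣ m !)
    prime∤factorial zero    _   p∣1 = ℕP.<-irrefl (sym (∣1⇒≡1 p∣1)) (ℕ.nonTrivial⇒n>1 p {{prime⇒nonTrivial p-prime}})
    prime∤factorial (suc m) m<p p∣m! with euclidsLemma (suc m) (m !) p-prime p∣m!
    ... | inj₁ p∣m+1 = ℕP.<-irrefl refl (ℕP.<-≤-trans m<p (∣⇒≤ p∣m+1))
    ... | inj₂ p∣m!  = prime∤factorial m (ℕP.<-trans (ℕP.n<1+n m) m<p) p∣m!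

    -- p C k · (k! (p-k)!) = p!, and p divides neither k! nor (p-k)!.
    prime∣binomial : ∀ k → 0 < k → k < p → p ∣ (p C k)
    prime∣binomial k 0<k k<p with euclidsLemma (p C k) (k ! * (p ∸ k) !) p-prime p∣product
      where
      k≤p = ℕP.<⇒≤ k<p
      product≡p! : (p C k) * (k ! * (p ∸ k) !) ≡ p !
      product≡p! = trans (cong (_* (k ! * (p ∸ k) !)) (nCk≡n!/k![n-k]! k≤p))
        (m/n*n≡m {{ℕP.m*n≢0 (k !) ((p ∸ k) !) {{k ℕP.!≢0}} {{(p ∸ k) ℕP.!≢0}}}} (k![n∸k]!∣n! k≤p))
      p∣product : p ∣ (p C k) * (k ! * (p ∸ k) !)
      p∣product = subst (p ∣_) (sym product≡p!) (m∣m*n (q !))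
    ... | inj₁ p∣C = p∣C
    ... | inj₂ p∣factorials with euclidsLemma (k !) ((p ∸ k) !) p-prime p∣factorials
    ...   | inj₁ p∣k!   = ⊥-elim (prime∤factorial k k<p p∣k!)
    ...   | inj₂ p∣p-k! = ⊥-elim (prime∤factorial (p ∸ k) (ℕP.∸-monoʳ-< {p} {k} {0} 0<k (ℕP.<⇒≤ k<p)) p∣p-k!)

    sum-up-to-last : ∀ n (f : Fin (suc n) → ℕ) → (∀ k → toℕ k < n → p ∣ f k) →
      ∃ λ t → Vector.foldr _+_ 0 f ≡ f (fromℕ n) + t * p
    sum-up-to-last zero    f _         = 0 , refl
    sum-up-to-last (suc n) f divisible with divisible zero (s≤s z≤n)
                                          | sum-up-to-last n (λ k → f (suc k)) (λ k k<n → divisible (suc k) (s≤s k<n))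
    ... | divides u f0≡up | t , rest≡ = u + t , trans (cong₂ _+_ f0≡up rest≡) (regroup u p (f (fromℕ (suc n))) t)
      where
      regroup : ∀ u p g t → u * p + (g + t * p) ≡ g + (u + t) * p
      regroup = solve-∀

    freshman : ∀ x y → ((x + y) ^ p) % p ≡ (x ^ p + y ^ p) % p
    freshman x y with sum-up-to-last q (λ k → term (suc k)) middle-divisible
      where
      term : Fin (suc p) → ℕ
      term = Binomial.binomialTerm x y p
      middle-divisible : ∀ k → toℕ k < q → p ∣ term (suc k)
      middle-divisible k k<q = subst (p ∣_) (sym (generic-× (p C suc (toℕ k)) _))
        (∣m⇒∣m*n _ (prime∣binomial (suc (toℕ k)) (s≤s z≤n) (s≤s k<q)))
    ... | t , tail≡ = begin
      ((x + y) ^ p) % p                       ≡⟨ cong (_% p) (sym (generic-^ (x + y) p)) ⟩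
      ((x + y) Generic.^ p) % p               ≡⟨ cong (_% p) (Binomial.theorem p x y) ⟩
      (first + Vector.foldr _+_ 0 (λ k → term (suc k))) % p
                                              ≡⟨ cong (λ s → (first + s) % p) tail≡ ⟩
      (first + (last + t * p)) % p            ≡⟨ cong (_% p) (sym (ℕP.+-assoc first last (t * p))) ⟩
      (first + last + t * p) % p              ≡⟨ [m+kn]%n≡m%n (first + last) t p ⟩
      (first + last) % p                      ≡⟨ cong₂ (λ a b → (a + b) % p) first≡ last≡ ⟩
      (y ^ p + x ^ p) % p                     ≡⟨ cong (_% p) (ℕP.+-comm (y ^ p) (x ^ p)) ⟩
      (x ^ p + y ^ p) % p                     ∎
      where
      open ≡-Reasoning
      term : Fin (suc p) → ℕ
      term = Binomial.binomialTerm x y p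
      first = term zero
      last  = term (fromℕ p)
      first≡ : first ≡ y ^ p
      first≡ = trans (ℕP.+-identityʳ _) (trans (ℕP.+-identityʳ _) (generic-^ y p))
      last≡ : last ≡ x ^ p
      last≡ = begin
        last                                     ≡⟨ generic-× (p C toℕ (fromℕ p)) _ ⟩
        (p C toℕ (fromℕ p)) * (x Generic.^ toℕ (fromℕ p) * y Generic.^ (p ∸ toℕ (fromℕ p)))
                                                 ≡⟨ cong (λ k → (p C k) * (x Generic.^ k * y Generic.^ (p ∸ k))) (toℕ-fromℕ p) ⟩
        (p C p) * (x Generic.^ p * y Generic.^ (p ∸ p))
                                                 ≡⟨ cong₂ (λ c e → c * (x Generic.^ p * y Generic.^ e)) (nCn≡1 p) (ℕP.n∸n≡0 p) ⟩
        1 * (x Generic.^ p * 1)                  ≡⟨ trans (ℕP.*-identityˡ _) (ℕP.*-identityʳ _) ⟩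
        x Generic.^ p                            ≡⟨ generic-^ x p ⟩
        x ^ p                                    ∎

    -- Induction on a with (a + 1)^p ≡ a^p + 1.
    fermat : ∀ a → (a ^ p) % p ≡ a % p
    fermat zero    = refl
    fermat (suc a) = begin
      (suc a ^ p) % p               ≡⟨ cong (λ b → (b ^ p) % p) (ℕP.+-comm 1 a) ⟩
      ((a + 1) ^ p) % p             ≡⟨ freshman a 1 ⟩
      (a ^ p + 1 ^ p) % p           ≡⟨ cong (λ o → (a ^ p + o) % p) (ℕP.^-zeroˡ p) ⟩
      (a ^ p + 1) % p               ≡⟨ %-distribˡ-+ (a ^ p) 1 p ⟩
      ((a ^ p) % p + 1 % p) % p     ≡⟨ cong (λ r → (r + 1 % p) % p) (fermat a) ⟩
      (a % p + 1 % p) % p           ≡⟨ sym (%-distribˡ-+ a 1 p) ⟩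
      (a + 1) % p                   ≡⟨ cong (_% p) (ℕP.+-comm a 1) ⟩
      suc a % p                     ∎
      where open ≡-Reasoning

module CubicSymbolValues where

  open FermatLittleTheorem using (fermat)
  open import Data.Nat as ℕ using (ℕ; zero; suc; _^_)
  import Data.Nat.Properties as ℕP
  import Data.Nat.DivMod as ℕD
  open import Data.Nat.Tactic.RingSolver as ℕRing using ()
  open import Data.Integer using (ℤ; +_; -[1+_]; _+_; _*_; _-_; -_; 1ℤ; 0ℤ; _%ℕ_; _/ℕ_)
  import Data.Integer.Properties as ℤP
  open import Data.Integer.DivMod using (a≡a%ℕn+[a/ℕn]*n; n%ℕd<d)
  open import Data.Integer.Tactic.RingSolver using (solve-∀)
  open import Data.Fin using (Fin; toℕ; fromℕ<)
  open import Data.Fin.Properties using (any?; toℕ-fromℕ<)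
  open import Data.Product using (_,_)
  open import Data.Empty using (⊥-elim)
  open import Relation.Nullary using (yes; no)
  open import Relation.Binary.PropositionalEquality

  cube-mod : ∀ x y d .{{_ : ℕ.NonZero d}} → x ℕ.% d ≡ y ℕ.% d → (x ℕ.* x ℕ.* x) ℕ.% d ≡ (y ℕ.* y ℕ.* y) ℕ.% d
  cube-mod x y d x≡y = begin
    (x ℕ.* x ℕ.* x) ℕ.% d                         ≡⟨ ℕD.%-distribˡ-* (x ℕ.* x) x d ⟩
    ((x ℕ.* x) ℕ.% d ℕ.* (x ℕ.% d)) ℕ.% d         ≡⟨ cong₂ (λ a b → (a ℕ.* b) ℕ.% d) square x≡y ⟩
    ((y ℕ.* y) ℕ.% d ℕ.* (y ℕ.% d)) ℕ.% d         ≡⟨ sym (ℕD.%-distribˡ-* (y ℕ.* y) y d) ⟩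
    (y ℕ.* y ℕ.* y) ℕ.% d                         ∎
    where
    open ≡-Reasoning
    square : (x ℕ.* x) ℕ.% d ≡ (y ℕ.* y) ℕ.% d
    square = trans (ℕD.%-distribˡ-* x x d) (trans (cong₂ (λ a b → (a ℕ.* b) ℕ.% d) x≡y x≡y) (sym (ℕD.%-distribˡ-* y y d)))

  -- For a prime p = 3t + 2, every residue r is a cube: r ≡ (r^(2t+1))³, since
  -- 3(2t+1) = (3t+1) + p and r^p ≡ r (Fermat), so the cube is r^(3t+2) = r^p ≡ r.
  module CubeRoots (q t : ℕ) (p-prime : Prime (suc q)) (p≡3t+2 : suc q ≡ 2 ℕ.+ t ℕ.* 3) where
    private
      p : ℕ
      p = suc q

      e : ℕ
      e = suc (2 ℕ.* t)

    cubeRoot : ℕ → ℕ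
    cubeRoot r = (r ^ e) ℕ.% p

    cubeRoot<p : ∀ r → cubeRoot r ℕ.< p
    cubeRoot<p r = ℕD.m%n<n (r ^ e) p

    cubeRoot-cubed : ∀ r → (cubeRoot r ℕ.* cubeRoot r ℕ.* cubeRoot r) ℕ.% p ≡ r ℕ.% p
    cubeRoot-cubed r = begin
      (cubeRoot r ℕ.* cubeRoot r ℕ.* cubeRoot r) ℕ.% p
        ≡⟨ cube-mod (cubeRoot r) (r ^ e) p (ℕD.m%n%n≡m%n (r ^ e) p) ⟩
      (r ^ e ℕ.* r ^ e ℕ.* r ^ e) ℕ.% p
        ≡⟨ cong (ℕ._% p) (sym (trans (ℕP.^-distribˡ-+-* r (e ℕ.+ e) e) (cong (ℕ._* r ^ e) (ℕP.^-distribˡ-+-* r e e)))) ⟩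
      (r ^ (e ℕ.+ e ℕ.+ e)) ℕ.% p
        ≡⟨ cong (λ e → (r ^ e) ℕ.% p) exponent ⟩
      (r ^ (suc (t ℕ.* 3) ℕ.+ p)) ℕ.% p
        ≡⟨ cong (ℕ._% p) (ℕP.^-distribˡ-+-* r (suc (t ℕ.* 3)) p) ⟩
      (r ^ suc (t ℕ.* 3) ℕ.* r ^ p) ℕ.% p
        ≡⟨ ℕD.%-distribˡ-* (r ^ suc (t ℕ.* 3)) (r ^ p) p ⟩
      ((r ^ suc (t ℕ.* 3)) ℕ.% p ℕ.* ((r ^ p) ℕ.% p)) ℕ.% p
        ≡⟨ cong (λ x → ((r ^ suc (t ℕ.* 3)) ℕ.% p ℕ.* x) ℕ.% p) (fermat q p-prime r) ⟩
      ((r ^ suc (t ℕ.* 3)) ℕ.% p ℕ.* (r ℕ.% p)) ℕ.% p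
        ≡⟨ sym (ℕD.%-distribˡ-* (r ^ suc (t ℕ.* 3)) r p) ⟩
      (r ^ suc (t ℕ.* 3) ℕ.* r) ℕ.% p
        ≡⟨ cong (ℕ._% p) (trans (ℕP.*-comm (r ^ suc (t ℕ.* 3)) r) (cong (r ^_) (sym p≡3t+2))) ⟩
      (r ^ p) ℕ.% p
        ≡⟨ fermat q p-prime r ⟩
      r ℕ.% p ∎
      where
      open ≡-Reasoning
      exponent : e ℕ.+ e ℕ.+ e ≡ suc (t ℕ.* 3) ℕ.+ p
      exponent = trans (identity t) (cong (suc (t ℕ.* 3) ℕ.+_) (sym p≡3t+2))
        where
        identity : ∀ t → suc (2 ℕ.* t) ℕ.+ suc (2 ℕ.* t) ℕ.+ suc (2 ℕ.* t) ≡ suc (t ℕ.* 3) ℕ.+ (2 ℕ.+ t ℕ.* 3)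
        identity = ℕRing.solve-∀

  multiple-%ℕ : ∀ d .{{_ : ℕ.NonZero d}} (k : ℤ) → (k * + d) %ℕ d ≡ 0
  multiple-%ℕ d (+ n)    = trans (cong (_%ℕ d) (sym (ℤP.pos-* n d))) (ℕD.m*n%n≡0 n d)
  multiple-%ℕ d -[1+ n ] =
    trans (cong (_%ℕ d) (trans (sym (ℤP.neg-distribˡ-* (+ suc n) (+ d))) (cong -_ (sym (ℤP.pos-* (suc n) d)))))
          (negated (suc n ℕ.* d) (ℕD.m*n%n≡0 (suc n) d))
    where
    negated : ∀ y → y ℕ.% d ≡ 0 → (- (+ y)) %ℕ d ≡ 0
    negated zero    0%d≡0 = 0%d≡0
    negated (suc y) y%d≡0 rewrite y%d≡0  = refl

  difference-%ℕ : ∀ d .{{_ : ℕ.NonZero d}} (u a : ℤ) → u %ℕ d ≡ a %ℕ d → (u - a) %ℕ d ≡ 0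
  difference-%ℕ d u a u≡a = trans (cong (_%ℕ d) u-a≡) (multiple-%ℕ d (u /ℕ d - a /ℕ d))
    where
    cancel : ∀ r x y d → (r + x * d) - (r + y * d) ≡ (x - y) * d
    cancel = solve-∀
    u-a≡ : u - a ≡ (u /ℕ d - a /ℕ d) * + d
    u-a≡ = trans (cong₂ _-_ (a≡a%ℕn+[a/ℕn]*n u d)
                            (trans (a≡a%ℕn+[a/ℕn]*n a d) (cong (λ r → + r + (a /ℕ d) * + d) (sym u≡a))))
                 (cancel (+ (u %ℕ d)) (u /ℕ d) (a /ℕ d) (+ d))

  cubicSymbol-divisible : ∀ a q → a %ℕ suc q ≡ 0 → cubicSymbol a (suc q) ≡ 0ℤ
  cubicSymbol-divisible a q a≡0 with a %ℕ suc q ℕ.≟ 0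
  ... | yes _  = refl
  ... | no a≢0 = ⊥-elim (a≢0 a≡0)

  cubicSymbol-cube : ∀ a q → a %ℕ suc q ≢ 0 → (x : Fin (suc q)) →
    ((+ toℕ x) * (+ toℕ x) * (+ toℕ x) - a) %ℕ suc q ≡ 0 → cubicSymbol a (suc q) ≡ 1ℤ
  cubicSymbol-cube a q a≢0 x x³≡a with a %ℕ suc q ℕ.≟ 0
  ... | yes a≡0 = ⊥-elim (a≢0 a≡0)
  ... | no _ with any? {n = suc q} (λ (y : Fin (suc q)) → ((+ toℕ y) * (+ toℕ y) * (+ toℕ y) - a) %ℕ suc q ℕ.≟ 0)
  ...   | yes _        = refl
  ...   | no no-cube   = ⊥-elim (no-cube (x , x³≡a))

  cubicSymbol-unit : ∀ q → Prime (suc q) → suc q ℕ.% 3 ≡ 2 →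
    ∀ a → a %ℕ suc q ≢ 0 → cubicSymbol a (suc q) ≡ 1ℤ
  cubicSymbol-unit q p-prime p%3≡2 a a≢0 =
    cubicSymbol-cube a q a≢0 x (difference-%ℕ (suc q) ((+ toℕ x) * (+ toℕ x) * (+ toℕ x)) a x³≡a)
    where
    t : ℕ
    t = suc q ℕ./ 3
    p≡3t+2 : suc q ≡ 2 ℕ.+ t ℕ.* 3
    p≡3t+2 = trans (ℕD.m≡m%n+[m/n]*n (suc q) 3) (cong (ℕ._+ t ℕ.* 3) p%3≡2)
    open CubeRoots q t p-prime p≡3t+2
    r : ℕ
    r = a %ℕ suc q
    x : Fin (suc q)
    x = fromℕ< (cubeRoot<p r)
    x³≡a : ((+ toℕ x) * (+ toℕ x) * (+ toℕ x)) %ℕ suc q ≡ a %ℕ suc q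
    x³≡a rewrite toℕ-fromℕ< (cubeRoot<p r)
               | sym (ℤP.pos-* (cubeRoot r) (cubeRoot r))
               | sym (ℤP.pos-* (cubeRoot r ℕ.* cubeRoot r) (cubeRoot r))
      = trans (cubeRoot-cubed r) (ℕD.m<n⇒m%n≡m (n%ℕd<d a (suc q)))

module DifferenceResidue (q : ℕ) where

  open import Data.Nat as ℕ using (ℕ; suc; _+_; _∸_; _<_; _≤_; _%_; _<?_; _≤?_)
  import Data.Nat.Properties as ℕP
  open import Data.Nat.DivMod using (m<n⇒m%n≡m; m≤n⇒[n∸m]%m≡n%m; n%n≡0)
  open import Data.Integer using (-_; +_; _⊖_; _%ℕ_)
  import Data.Integer.Properties as ℤP
  open import Data.Sum using (_⊎_; inj₁; inj₂)
  open import Data.Empty using (⊥-elim)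
  open import Relation.Nullary using (yes; no)
  open import Relation.Binary.PropositionalEquality

  private
    P : ℕ
    P = suc q

  multiple-below-2P : ∀ x → x < P + P → x % P ≡ 0 → x ≡ 0 ⊎ x ≡ P
  multiple-below-2P x x<2P x%P≡0 with x <? P
  ... | yes x<P = inj₁ (trans (sym (m<n⇒m%n≡m x<P)) x%P≡0)
  ... | no  x≮P = inj₂ (ℕP.≤-antisym (ℕP.m∸n≡0⇒m≤n x∸P≡0) P≤x)
    where
    P≤x : P ≤ x
    P≤x = ℕP.≮⇒≥ x≮P
    x∸P≡0 : x ∸ P ≡ 0
    x∸P≡0 = trans (sym (m<n⇒m%n≡m (ℕP.m<n+o⇒m∸n<o x P x<2P))) (trans (m≤n⇒[n∸m]%m≡n%m P≤x) x%P≡0)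

  -- the residue of -w is P - w ≠ 0 for 0 < w < P
  negative-residue : ∀ w → 0 < w → w < P → (- (+ w)) %ℕ P ≢ 0
  negative-residue (suc y) _ w<P rewrite m<n⇒m%n≡m w<P = ℕP.m>n⇒m∸n≢0 w<P

  difference-divisible⇒ : ∀ {a s} → a < P → s < P + P → (s ⊖ a) %ℕ P ≡ 0 → s ≡ a ⊎ s ≡ a + P
  difference-divisible⇒ {a} {s} a<P s<2P divisible with a ≤? s
  ... | yes a≤s rewrite ℤP.⊖-≥ a≤s with multiple-below-2P (s ∸ a) (ℕP.≤-<-trans (ℕP.m∸n≤m s a) s<2P) divisible
  ...   | inj₁ s∸a≡0 = inj₁ (ℕP.≤-antisym (ℕP.m∸n≡0⇒m≤n s∸a≡0) a≤s)
  ...   | inj₂ s∸a≡P = inj₂ (trans (sym (ℕP.m+[n∸m]≡n a≤s)) (cong (a ℕ.+_) s∸a≡P))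
  difference-divisible⇒ {a} {s} a<P s<2P divisible | no a≰s rewrite ℤP.⊖-< (ℕP.≰⇒> a≰s) =
    ⊥-elim (negative-residue (a ∸ s) (ℕP.m<n⇒0<n∸m (ℕP.≰⇒> a≰s)) (ℕP.≤-<-trans (ℕP.m∸n≤m a s) a<P) divisible)

  difference-divisible⇐ : ∀ {a s} → s ≡ a ⊎ s ≡ a + P → (s ⊖ a) %ℕ P ≡ 0
  difference-divisible⇐ {a} (inj₁ refl) rewrite ℤP.n⊖n≡0 a = refl
  difference-divisible⇐ {a} (inj₂ refl) rewrite ℤP.⊖-≥ (ℕP.m≤m+n a P) | ℕP.m+n∸m≡n a P = n%n≡0 P

module ShiftPattern where

  open import Data.Nat as ℕ using (ℕ; suc; _+_; _<_; _≤_)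
  import Data.Nat.Properties as ℕP
  open import Data.Nat.Tactic.RingSolver using (solve-∀)
  open import Data.Sum using (_⊎_; inj₁; inj₂)
  open import Data.Empty using (⊥-elim)
  open import Function.Bundles using (_⇔_; mk⇔)
  open import Relation.Nullary using (Dec; ¬_)
  open import Relation.Nullary.Decidable using (_⊎-dec_)
  open import Relation.Binary.PropositionalEquality

  -- With c = 1 + k and p = c + d + 1, the index pair (a , b) (0 ≤ a, b < p - 1)
  -- is a zero of the matrix [(b - a + c)/p] exactly when b + c ≡ a (mod p),
  -- i.e. when b + c = a or b + c = a + p.
  Hit : ℕ → ℕ → ℕ → ℕ → Set
  Hit k d a b = (b + suc k ≡ a) ⊎ (b + suc k ≡ a + suc (suc k + d))

  hit? : ∀ k d a b → Dec (Hit k d a b)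
  hit? k d a b = (b + suc k ℕ.≟ a) ⊎-dec (b + suc k ℕ.≟ a + suc (suc k + d))

  -- Row k is never hit: it is the row of ones of the matrix.
  no-hit-in-row-k : ∀ k d b → b < suc k + d → ¬ Hit k d k b
  no-hit-in-row-k k d b _ (inj₁ eq) =
    ℕP.<⇒≢ (ℕP.<-≤-trans (ℕP.n<1+n k) (ℕP.m≤n+m (suc k) b)) (sym eq)
  no-hit-in-row-k k d b b<m (inj₂ eq) =
    ℕP.<⇒≢ (subst (b + suc k <_) (identity k d) (ℕP.+-monoˡ-< (suc k) b<m)) eq
    where
    identity : ∀ k d → suc k + d + suc k ≡ k + suc (suc k + d)
    identity = solve-∀

  hit-low-column : ∀ k d t b → b < suc k + d → Hit k d (t + suc k) b ⇔ (b ≡ t)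
  hit-low-column k d t b b<m = mk⇔ to (λ { refl → inj₁ refl })
    where
    identity : ∀ t k d → t + suc k + suc (suc k + d) ≡ t + suc (suc k + d) + suc k
    identity = solve-∀
    to : Hit k d (t + suc k) b → b ≡ t
    to (inj₁ eq) = ℕP.+-cancelʳ-≡ (suc k) b t eq
    to (inj₂ eq) = ⊥-elim (ℕP.<⇒≢ (ℕP.<-≤-trans b<m (ℕP.≤-trans (ℕP.n≤1+n _) (ℕP.m≤n+m _ t)))
                                   (ℕP.+-cancelʳ-≡ (suc k) b _ (trans eq (identity t k d))))

  hit-high-column : ∀ k d q b → q < k → Hit k d q b ⇔ (b ≡ suc d + q)
  hit-high-column k d q b q<k = mk⇔ to (λ { refl → inj₂ (identity q k d) })
    where
    identity : ∀ q k d → suc d + q + suc k ≡ q + suc (suc k + d)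
    identity = solve-∀
    to : Hit k d q b → b ≡ suc d + q
    to (inj₁ eq) = ⊥-elim (ℕP.<⇒≢ (ℕP.<-≤-trans q<k (ℕP.≤-trans (ℕP.n≤1+n k) (ℕP.m≤n+m (suc k) b))) (sym eq))
    to (inj₂ eq) = ℕP.+-cancelʳ-≡ (suc k) b (suc d + q) (trans eq (sym (identity q k d)))

  -- Passing from c = k + 2 to c = k + 1 (same d) deletes row 0 and column d + 1
  -- of the pattern: rows move up by one, columns b ≤ d stay.
  hit-shift-left : ∀ k d a b → b ≤ d → Hit (suc k) d (suc a) b ⇔ Hit k d a b
  hit-shift-left k d a b b≤d = mk⇔ to from
    where
    small : b + suc k < a + suc (suc k + d)
    small = ℕP.≤-<-trans (subst (b + suc k ≤_) (ℕP.+-comm d (suc k)) (ℕP.+-monoˡ-≤ (suc k) b≤d))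
                         (ℕP.<-≤-trans (ℕP.n<1+n _) (ℕP.m≤n+m _ a))
    to : Hit (suc k) d (suc a) b → Hit k d a b
    to (inj₁ eq) = inj₁ (ℕP.suc-injective (trans (sym (ℕP.+-suc b (suc k))) eq))
    to (inj₂ eq) = ⊥-elim (ℕP.<⇒≢ (ℕP.m<n⇒m<1+n small)
      (ℕP.suc-injective (trans (sym (ℕP.+-suc b (suc k))) (trans eq (cong suc (ℕP.+-suc a (suc (suc k + d))))))))
    from : Hit k d a b → Hit (suc k) d (suc a) b
    from (inj₁ eq) = inj₁ (trans (ℕP.+-suc b (suc k)) (cong suc eq))
    from (inj₂ eq) = ⊥-elim (ℕP.<⇒≢ small eq)


  hit-shift-right : ∀ k d a b → suc d ≤ b → a < suc k + d → Hit (suc k) d (suc a) (suc b) ⇔ Hit k d a b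
  hit-shift-right k d a b d<b a<m = mk⇔ to from
    where
    big : a < b + suc k
    big = ℕP.<-≤-trans a<m (subst (_≤ b + suc k) (ℕP.+-comm d (suc k)) (ℕP.+-monoˡ-≤ (suc k) (ℕP.<⇒≤ d<b)))
    column : ∀ b k → suc b + suc (suc k) ≡ suc (suc (b + suc k))
    column = solve-∀
    row : ∀ a k d → suc a + suc (suc (suc k) + d) ≡ suc (suc (a + suc (suc k + d)))
    row = solve-∀
    to : Hit (suc k) d (suc a) (suc b) → Hit k d a b
    to (inj₁ eq) = ⊥-elim (ℕP.<⇒≢ (ℕP.<-trans big (ℕP.n<1+n _)) (sym (ℕP.suc-injective (trans (sym (column b k)) eq))))
    to (inj₂ eq) = inj₂ (ℕP.suc-injective (ℕP.suc-injective (trans (sym (column b k)) (trans eq (row a k d)))))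
    from : Hit k d a b → Hit (suc k) d (suc a) (suc b)
    from (inj₁ eq) = ⊥-elim (ℕP.<⇒≢ big (sym eq))
    from (inj₂ eq) = inj₂ (trans (column b k) (trans (cong (λ x → suc (suc x)) eq) (sym (row a k d))))

module PatternDeterminant where

  open Determinants
  open ShiftPattern
  open import Data.Nat as ℕ using (ℕ; zero; suc; _<_; _≤_; s≤s; _<?_; s≤s⁻¹)
  import Data.Nat.Properties as ℕP
  open import Data.Integer using (ℤ; _+_; _*_; _-_; -_; 1ℤ; 0ℤ; -1ℤ)
  import Data.Integer.Properties as ℤP
  open import Data.Integer.Tactic.RingSolver using (solve-∀)
  open import Data.Bool using (if_then_else_)
  open import Data.Fin using (Fin; zero; suc; toℕ; punchIn; _≟_; fromℕ<; fromℕ)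
  open import Data.Fin.Properties using (punchInᵢ≢i; toℕ-injective; toℕ-fromℕ<; toℕ-fromℕ; toℕ<n)
  open import Data.Product using (Σ; _×_; _,_)
  open import Function.Bundles using (_⇔_; mk⇔)
  open import Function.Properties.Equivalence using () renaming (trans to ⇔-trans)
  open import Relation.Nullary using (¬_; yes; no; does)
  open import Relation.Nullary.Decidable using (dec-true; dec-false)
  open import Relation.Binary.PropositionalEquality

  toℕ-punchIn-below : ∀ {n} (v : Fin (suc n)) (x : Fin n) → toℕ x < toℕ v → toℕ (punchIn v x) ≡ toℕ x
  toℕ-punchIn-below (suc v) zero    _         = refl
  toℕ-punchIn-below (suc v) (suc x) (s≤s x<v) = cong suc (toℕ-punchIn-below v x x<v)

  toℕ-punchIn-above : ∀ {n} (v : Fin (suc n)) (x : Fin n) → toℕ v ≤ toℕ x → toℕ (punchIn v x) ≡ suc (toℕ x)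
  toℕ-punchIn-above zero    x       _         = refl
  toℕ-punchIn-above (suc v) (suc x) (s≤s v≤x) = cong suc (toℕ-punchIn-above v x v≤x)

  toℕ-≡⇔ : ∀ {n} {i j : Fin n} → (toℕ i ≡ toℕ j) ⇔ (i ≡ j)
  toℕ-≡⇔ = mk⇔ toℕ-injective (cong toℕ)

  shift : ∀ k d → Matrix (suc k ℕ.+ d)
  shift k d i j = χ (hit? k d (toℕ i) (toℕ j))

  onesMinusShift : ∀ k d → Matrix (suc k ℕ.+ d)
  onesMinusShift k d i j = 1ℤ - shift k d i j

  reducedEntry : ℕ → ℕ → ℕ → ℕ → ℤ
  reducedEntry k d a b = if does (a ℕ.≟ k) then χ (b ℕ.≟ d) else - χ (hit? k d a b)

  reduced : ∀ k d → Matrix (suc k ℕ.+ d)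
  reduced k d i j = reducedEntry k d (toℕ i) (toℕ j)

  module _ (k d : ℕ) where

    private
      z : Fin (suc k ℕ.+ d)
      z = fromℕ< (ℕP.m≤m+n (suc k) d)

      toℕ-z : toℕ z ≡ k
      toℕ-z = toℕ-fromℕ< (ℕP.m≤m+n (suc k) d)

      v : Fin (suc k ℕ.+ d)
      v = fromℕ< (s≤s (ℕP.m≤n+m d k))

      toℕ-v : toℕ v ≡ d
      toℕ-v = toℕ-fromℕ< (s≤s (ℕP.m≤n+m d k))

      row-k : ∀ {i} → i ≢ z → toℕ i ≢ k
      row-k i≢z eq = i≢z (toℕ-injective (trans eq (sym toℕ-z)))

      not-row-k : ∀ {i} → toℕ i ≢ k → i ≢ z
      not-row-k i≢k i≡z = i≢k (trans (cong toℕ i≡z) toℕ-z)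

      ones-in-row-k : ∀ j → onesMinusShift k d z j ≡ 1ℤ
      ones-in-row-k j = cong (λ s → 1ℤ - s) (χ-no (hit? k d (toℕ z) (toℕ j))
        (subst (λ a → ¬ Hit k d a (toℕ j)) (sym toℕ-z) (no-hit-in-row-k k d (toℕ j) (toℕ<n j))))

      U : Matrix (suc k ℕ.+ d)
      U = setRow (λ i j → - shift k d i j) z (λ _ → 1ℤ)

      column-partner : ∀ t → toℕ t ≢ d → Σ (Fin (suc k ℕ.+ d)) λ i → (i ≢ z) × (∀ j → shift k d i j ≡ unitRow t j)
      column-partner t t≢d with toℕ t <? d
      ... | yes t<d = i , not-row-k (λ eq → i≢k (trans (sym toℕ-i) eq)) , λ j →
            χ-⇔ (subst (λ a → Hit k d a (toℕ j) ⇔ (j ≡ t)) (sym toℕ-i)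
                  (⇔-trans (hit-low-column k d (toℕ t) (toℕ j) (toℕ<n j)) toℕ-≡⇔))
                  (hit? k d (toℕ i) (toℕ j)) (j ≟ t)
        where
        bound : toℕ t ℕ.+ suc k < suc k ℕ.+ d
        bound = subst (toℕ t ℕ.+ suc k <_) (ℕP.+-comm d (suc k)) (ℕP.+-monoˡ-< (suc k) t<d)
        i : Fin (suc k ℕ.+ d)
        i = fromℕ< bound
        toℕ-i : toℕ i ≡ toℕ t ℕ.+ suc k
        toℕ-i = toℕ-fromℕ< bound
        i≢k : toℕ t ℕ.+ suc k ≢ k
        i≢k eq = ℕP.<⇒≢ (ℕP.<-≤-trans (ℕP.n<1+n k) (ℕP.m≤n+m (suc k) (toℕ t))) (sym eq)
      ... | no t≮d with ℕP.m≤n⇒∃[o]m+o≡n (ℕP.≤∧≢⇒< (ℕP.≮⇒≥ t≮d) (λ eq → t≢d (sym eq)))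
      ...   | q , d+q≡t = i , not-row-k (λ eq → ℕP.<⇒≢ q<k (trans (sym toℕ-i) eq)) , λ j →
            χ-⇔ (subst (λ a → Hit k d a (toℕ j) ⇔ (j ≡ t)) (sym toℕ-i)
                  (⇔-trans (hit-high-column k d q (toℕ j) q<k)
                    (⇔-trans (mk⇔ (λ eq → trans eq d+q≡t) (λ eq → trans eq (sym d+q≡t))) toℕ-≡⇔)))
                  (hit? k d (toℕ i) (toℕ j)) (j ≟ t)
        where
        q<k : q < k
        q<k = ℕP.+-cancelˡ-< (suc d) q k
                (subst₂ _<_ (sym d+q≡t) (cong suc (ℕP.+-comm k d)) (toℕ<n t))
        q<m : q < suc k ℕ.+ d
        q<m = ℕP.<-≤-trans q<k (ℕP.≤-trans (ℕP.n≤1+n k) (ℕP.m≤m+n (suc k) d))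
        i : Fin (suc k ℕ.+ d)
        i = fromℕ< q<m
        toℕ-i : toℕ i ≡ q
        toℕ-i = toℕ-fromℕ< q<m

    -- Subtracting row k (all ones) from the other rows leaves the negated
    -- pattern; then the row of ones collapses to the unit row of column d, the
    -- only column not hit by any other row.
    det-onesMinusShift : det (suc k ℕ.+ d) (onesMinusShift k d) ≡ det (suc k ℕ.+ d) (reduced k d)
    det-onesMinusShift = begin
      det (suc k ℕ.+ d) (onesMinusShift k d)
        ≡⟨ det-clear-by-row (onesMinusShift k d) U z
             (λ j → trans (setRow-≡ _ z _ j) (sym (ones-in-row-k j)))
             (λ i i≢z j → cong₂ _+_ (sym (ones-in-row-k j)) (sym (setRow-≢ _ z _ i≢z j))) ⟩
      det (suc k ℕ.+ d) U
        ≡⟨ det-ones-row (k ℕ.+ d) U (reduced k d) z v (setRow-≡ _ z _) cancels agree row-z ⟩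
      det (suc k ℕ.+ d) (reduced k d) ∎
      where
      open ≡-Reasoning
      cancels : ∀ x → Σ (Fin (suc k ℕ.+ d)) λ i → (i ≢ z) × (∀ j → U i j ≡ - unitRow (punchIn v x) j)
      cancels x with column-partner (punchIn v x) (λ eq → punchInᵢ≢i v x (toℕ-injective (trans eq (sym toℕ-v))))
      ... | i , i≢z , unit = i , i≢z , λ j → trans (setRow-≢ _ z _ i≢z j) (cong -_ (unit j))
      agree : SameOffRow U (reduced k d) z
      agree i i≢z j rewrite dec-false (toℕ i ℕ.≟ k) (row-k i≢z) = setRow-≢ _ z _ i≢z j
      row-z : ∀ j → reduced k d z j ≡ unitRow v j
      row-z j rewrite dec-true (toℕ z ℕ.≟ k) toℕ-z =
        χ-⇔ (⇔-trans (mk⇔ (λ eq → trans eq (sym toℕ-v)) (λ eq → trans eq toℕ-v)) toℕ-≡⇔) (toℕ j ℕ.≟ d) (j ≟ v)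

  reduced-minor-left : ∀ k d a b → b ≤ d → reducedEntry (suc k) d (suc a) b ≡ reducedEntry k d a b
  reduced-minor-left k d a b b≤d =
    cong (λ x → if does (a ℕ.≟ k) then χ (b ℕ.≟ d) else - x)
         (χ-⇔ (hit-shift-left k d a b b≤d) (hit? (suc k) d (suc a) b) (hit? k d a b))

  reduced-minor-right : ∀ k d a b → suc d ≤ b → a < suc k ℕ.+ d →
    reducedEntry (suc k) d (suc a) (suc b) ≡ reducedEntry k d a b
  reduced-minor-right k d a b d<b a<m =
    cong₂ (λ x y → if does (a ℕ.≟ k) then x else - y)
          (trans (χ-no (suc b ℕ.≟ d) (λ eq → ℕP.<⇒≢ (ℕP.m<n⇒m<1+n d<b) (sym eq)))
                 (sym (χ-no (b ℕ.≟ d) (λ eq → ℕP.<⇒≢ d<b (sym eq)))))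
          (χ-⇔ (hit-shift-right k d a b d<b a<m) (hit? (suc k) d (suc a) (suc b)) (hit? k d a b))

  -- Expanding along row 0 each time: for k = 0 row 0 is the unit row of the
  -- last column and the minor is -I; for k > 0 row 0 is minus the unit row of
  -- column d + 1, and the minor is the same matrix for k - 1.
  det-reduced : ∀ k d → det (suc k ℕ.+ d) (reduced k d) ≡ signℤ (k ℕ.* d)
  det-reduced zero d = begin
    det (suc d) (reduced 0 d)
      ≡⟨ det-single-entry d (reduced 0 d) (fromℕ d) 1ℤ entry others ⟩
    signℤ (toℕ (fromℕ d)) * 1ℤ * det d (minor (reduced 0 d) (fromℕ d))
      ≡⟨ cong₂ (λ s D → signℤ s * 1ℤ * D) (toℕ-fromℕ d) (trans (det-cong d minor≡) (det-neg-identity d)) ⟩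
    signℤ d * 1ℤ * signℤ d
      ≡⟨ trans (cong (_* signℤ d) (ℤP.*-identityʳ (signℤ d))) (sign-sq d) ⟩
    1ℤ ∎
    where
    open ≡-Reasoning
    entry : reduced 0 d zero (fromℕ d) ≡ 1ℤ
    entry = χ-yes (toℕ (fromℕ d) ℕ.≟ d) (toℕ-fromℕ d)
    others : ∀ x → reduced 0 d zero (punchIn (fromℕ d) x) ≡ 0ℤ
    others x = χ-no (toℕ (punchIn (fromℕ d) x) ℕ.≟ d)
                    (λ eq → punchInᵢ≢i (fromℕ d) x (toℕ-injective (trans eq (sym (toℕ-fromℕ d)))))
    minor≡ : ∀ i x → minor (reduced 0 d) (fromℕ d) i x ≡ negIdentity d i x
    minor≡ i x rewrite toℕ-punchIn-below (fromℕ d) x (subst (toℕ x <_) (sym (toℕ-fromℕ d)) (toℕ<n x)) =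
      cong -_ (χ-⇔ (⇔-trans hits toℕ-≡⇔) (hit? 0 d (suc (toℕ i)) (toℕ x)) (x ≟ i))
      where
      hits : Hit 0 d (suc (toℕ i)) (toℕ x) ⇔ (toℕ x ≡ toℕ i)
      hits = subst (λ a → Hit 0 d a (toℕ x) ⇔ (toℕ x ≡ toℕ i)) (ℕP.+-comm (toℕ i) 1)
                   (hit-low-column 0 d (toℕ i) (toℕ x) (ℕP.m<n⇒m<1+n (toℕ<n x)))
  det-reduced (suc k) d = begin
    det (suc (suc k ℕ.+ d)) (reduced (suc k) d)
      ≡⟨ det-single-entry (suc k ℕ.+ d) (reduced (suc k) d) v -1ℤ entry others ⟩
    signℤ (toℕ v) * -1ℤ * det (suc k ℕ.+ d) (minor (reduced (suc k) d) v)
      ≡⟨ cong₂ (λ s D → signℤ s * -1ℤ * D) toℕ-v (trans (det-cong (suc k ℕ.+ d) minor≡) (det-reduced k d)) ⟩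
    signℤ (suc d) * -1ℤ * signℤ (k ℕ.* d)
      ≡⟨ cong (λ s → s * -1ℤ * signℤ (k ℕ.* d)) (sign-suc d) ⟩
    - signℤ d * -1ℤ * signℤ (k ℕ.* d)
      ≡⟨ cancel (signℤ d) (signℤ (k ℕ.* d)) ⟩
    signℤ d * signℤ (k ℕ.* d)
      ≡⟨ sym (sign-+ d (k ℕ.* d)) ⟩
    signℤ (suc k ℕ.* d) ∎
    where
    open ≡-Reasoning
    cancel : ∀ a b → - a * -1ℤ * b ≡ a * b
    cancel = solve-∀
    d+1<m : suc d < suc (suc k) ℕ.+ d
    d+1<m = s≤s (s≤s (ℕP.m≤n+m d k))
    v : Fin (suc (suc k) ℕ.+ d)
    v = fromℕ< d+1<m
    toℕ-v : toℕ v ≡ suc d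
    toℕ-v = toℕ-fromℕ< d+1<m
    first-row : ∀ j → reduced (suc k) d zero j ≡ - unitRow v j
    first-row j = cong -_ (χ-⇔ (⇔-trans (hit-high-column (suc k) d 0 (toℕ j) (s≤s ℕ.z≤n))
                                (⇔-trans (mk⇔ (λ eq → trans eq (trans (ℕP.+-identityʳ (suc d)) (sym toℕ-v)))
                                              (λ eq → trans eq (trans toℕ-v (sym (ℕP.+-identityʳ (suc d))))))
                                         toℕ-≡⇔))
                               (hit? (suc k) d 0 (toℕ j)) (j ≟ v))
    entry : reduced (suc k) d zero v ≡ -1ℤ
    entry = trans (first-row v) (cong -_ (χ-yes (v ≟ v) refl))
    others : ∀ x → reduced (suc k) d zero (punchIn v x) ≡ 0ℤ
    others x = trans (first-row (punchIn v x)) (cong -_ (χ-no (punchIn v x ≟ v) (punchInᵢ≢i v x)))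
    minor≡ : ∀ i x → minor (reduced (suc k) d) v i x ≡ reduced k d i x
    minor≡ i x with toℕ x <? suc d
    ... | yes x≤d rewrite toℕ-punchIn-below v x (subst (toℕ x <_) (sym toℕ-v) x≤d) =
      reduced-minor-left k d (toℕ i) (toℕ x) (s≤s⁻¹ x≤d)
    ... | no  x≰d rewrite toℕ-punchIn-above v x (subst (_≤ toℕ x) (sym toℕ-v) (ℕP.≮⇒≥ x≰d)) =
      reduced-minor-right k d (toℕ i) (toℕ x) (ℕP.≮⇒≥ x≰d) (toℕ<n i)

open Determinants
open CubicSymbolValues
open ShiftPattern
open PatternDeterminant
open import Data.Nat as ℕ using (zero; suc; _<_)
import Data.Nat.Properties as ℕP
open import Data.Integer using (+_; _+_; _*_; _-_; _⊖_)
import Data.Integer.Properties as ℤP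
open import Data.Integer.Tactic.RingSolver using (solve-∀)
open import Data.Fin using (toℕ)
open import Data.Fin.Properties using (toℕ<n)
open import Data.Product using (_,_)
open import Relation.Nullary using (Dec; yes; no)
open import Relation.Binary.PropositionalEquality

difference-value : ∀ a b c → + b - + a + + c ≡ (b ℕ.+ c) ⊖ a
difference-value a b c = begin
  + b - + a + + c       ≡⟨ reorder (+ b) (+ a) (+ c) ⟩
  (+ b + + c) - + a     ≡⟨ cong (_- + a) (sym (ℤP.pos-+ b c)) ⟩
  + (b ℕ.+ c) - + a     ≡⟨ ℤP.m-n≡m⊖n (b ℕ.+ c) a ⟩
  (b ℕ.+ c) ⊖ a         ∎
  where
  open ≡-Reasoning
  reorder : ∀ x y z → x - y + z ≡ (x + z) - y
  reorder = solve-∀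

-- The entries of the cubic matrix: with c = 1 + k and p = c + d + 1, the
-- symbol [(j - i + c)/p] is 0 where the pattern is hit (p divides j - i + c)
-- and 1 elsewhere (every nonzero residue is a cube as p ≡ 2 (mod 3)).
cubicMatrix-entries : ∀ k d → Prime (suc (suc k ℕ.+ d)) → suc (suc k ℕ.+ d) % 3 ≡ 2 →
  ∀ i j → cubicMatrix (suc (suc k ℕ.+ d)) (suc k) i j ≡ onesMinusShift k d i j
cubicMatrix-entries k d p-prime p≡2 i j =
  trans (cong (λ a → cubicSymbol a (suc (suc k ℕ.+ d))) (difference-value (toℕ i) (toℕ j) (suc k)))
        (symbol (hit? k d (toℕ i) (toℕ j)))
  where
  open DifferenceResidue (suc k ℕ.+ d)
  i<p : toℕ i < suc (suc k ℕ.+ d)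
  i<p = ℕP.m<n⇒m<1+n (toℕ<n i)
  j+c<2p : toℕ j ℕ.+ suc k < suc (suc k ℕ.+ d) ℕ.+ suc (suc k ℕ.+ d)
  j+c<2p = ℕP.<-≤-trans (ℕP.+-mono-<-≤ (toℕ<n j) (ℕP.m≤m+n (suc k) d))
                        (ℕP.+-mono-≤ (ℕP.n≤1+n (suc k ℕ.+ d)) (ℕP.n≤1+n (suc k ℕ.+ d)))
  symbol : (hit : Dec (Hit k d (toℕ i) (toℕ j))) →
    cubicSymbol ((toℕ j ℕ.+ suc k) ⊖ toℕ i) (suc (suc k ℕ.+ d)) ≡ 1ℤ - χ hit
  symbol (yes hit)  = cubicSymbol-divisible ((toℕ j ℕ.+ suc k) ⊖ toℕ i) (suc k ℕ.+ d) (difference-divisible⇐ hit)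
  symbol (no  miss) = cubicSymbol-unit (suc k ℕ.+ d) p-prime p≡2 ((toℕ j ℕ.+ suc k) ⊖ toℕ i)
                        (λ divisible → miss (difference-divisible⇒ i<p j+c<2p divisible))

theorem3p9 : (p : ℕ) → Prime p → p % 2 ≡ 1 → p % 3 ≡ 2 →
    (c : ℕ) → 1 ≤ c → c ≤ p ∸ 1 →
    det (p ∸ 1) (cubicMatrix p c) ≡ 1ℤ
theorem3p9 zero    _       ()
theorem3p9 (suc m) _       _     _   zero    ()
theorem3p9 (suc m) p-prime p-odd p≡2 (suc k) _  c≤m with ℕP.m≤n⇒∃[o]m+o≡n c≤m
... | d , refl = begin
  det (suc k ℕ.+ d) (cubicMatrix (suc (suc k ℕ.+ d)) (suc k))
    ≡⟨ det-cong (suc k ℕ.+ d) (cubicMatrix-entries k d p-prime p≡2) ⟩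
  det (suc k ℕ.+ d) (onesMinusShift k d)
    ≡⟨ det-onesMinusShift k d ⟩
  det (suc k ℕ.+ d) (reduced k d)
    ≡⟨ det-reduced k d ⟩
  signℤ (k ℕ.* d)
    ≡⟨ sign-product-even k d p-odd ⟩
  1ℤ ∎
  where open ≡-Reasoning
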